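{- Let $p',q'$ be positive integers and put $n=p'+q'-1$. Define the map $g$ on $[0,n-1]=\{c\in\mathbb{Z}: 0\le c\le n-1\}$ by $$g(i)=\begin{cases} i+p' & \text{if } i\in[0,q'-2],\\ i+p'-q' & \text{if } i=q'-1,\\ i-q' & \text{if } i\in[q',n-1].\end{cases}$$ Then $g$ is a permutation of $[0,n-1]$, and, with $\lambda=\gcd(p',q')$, $g$ has exactly $\lambda$ orbits. More precisely, for every $i\in[0,n-1]$ the orbit of $i$ under $g$ equals $\{j\in[0,n-1] : j\equiv i \pmod{\lambda}\}$.
   Context: For integers $a\le b$, $[a,b]$ denotes $\{c\in\mathbb{Z}: a\le c\le b\}$. -}

module Defs where

open import Data.Nat using (ℕ; zero; suc; _+_; _∸_; _<_; _<ᵇ_; _≡ᵇ_)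
open import Data.Bool using (if_then_else_)

-- The map g on [0, n-1] (n = p' + q' - 1), extended arbitrarily (by the same
-- formula) to all of ℕ; only its values on i < n matter.
--   g(i) = i + p'        if i ≤ q' - 2   (i.e. i < q' - 1)
--   g(i) = i + p' - q'   if i = q' - 1
--   g(i) = i - q'        otherwise (i ∈ [q', n-1])
-- For p' ≥ 1 the truncated subtraction in the middle case is exact.
g : ℕ → ℕ → ℕ → ℕ
g p' q' i =
  if i <ᵇ (q' ∸ 1) then i + p'
  else if i ≡ᵇ (q' ∸ 1) then (i + p') ∸ q'
  else i ∸ q'

iter : (ℕ → ℕ) → ℕ → ℕ → ℕ
iter f zero    x = x
iter f (suc k) x = f (iter f k x)

{-# OPTIONS --safe #-}
-- Up to one point, g is a rotation. The rotation r x = (x + p') mod (p' + q') of [0, n] agrees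
-- with g except at q' - 1, where r (q' - 1) = n and r n = p' - 1 = g (q' - 1): so g is r with the
-- point n skipped, and the g-orbit of i < n is the r-orbit of i without n. By Bézout the r-orbits
-- are the residue classes modulo gcd(p', p' + q') = gcd(p', q'). Injectivity: g q' p' inverts g p' q'.
module Submission where

open import Defs
open import Data.Nat using (ℕ; _+_; _∸_; _<_; _≤_)
open import Data.Nat.GCD using (gcd)
open import Data.Integer using (+_; _-_)
open import Data.Integer.Divisibility using (_∣_)
open import Data.Product using (_×_; ∃)
open import Relation.Binary.PropositionalEquality using (_≡_)
open import Function.Bundles using (_⇔_)

open import Data.Bool using (Bool; true; false; T; if_then_else_)
open import Data.Empty using (⊥-elim)
open import Data.Nat using (zero; suc; s≤s; _*_; _%_; NonZero; z<s)
open import Data.Nat.Properties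
  using (_≟_; <-cmp; <-irrefl; <-trans; ≤-<-trans; m<n⇒m<1+n; m≤n+m; <⇒≤; <⇒≢; ≤⇒≯; ≤-refl; ≤-total;
         +-comm; +-suc; +-identityʳ; *-assoc;
         +-monoˡ-<; +-cancelˡ-<; m≤m+n; m<m+n; m<n+m; m+n∸m≡n; m+[n∸m]≡n; <⇒<ᵇ; <ᵇ⇒<; ≡⇒≡ᵇ; ≡ᵇ⇒≡)
open import Data.Nat.DivMod
  using (%-distribˡ-+; %-distribˡ-*; m%n%n≡m%n; [m+n]%n≡m%n; [m+kn]%n≡m%n; m<n⇒m%n≡m; m%n<n)
open import Data.Nat.Divisibility using (divides) renaming (_∣_ to _∣ℕ_)
open import Data.Nat.GCD using (GCD; module GCD; gcd-GCD; gcd[m,n]∣m; gcd[m,n]∣n; module Bézout)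
import Data.Nat.Tactic.RingSolver as ℕ-Solver
open import Data.Integer as ℤ using (-_; _⊖_; ∣_∣)
open import Data.Integer.Properties
  using (pos-+; +-inverseʳ; [+m]-[+n]≡m⊖n; [1+m]⊖[1+n]≡m⊖n; ∣m⊖n∣≡∣n⊖m∣; ∣⊖∣-≤)
open import Data.Integer.Divisibility.Signed
  using (divides; ∣m∣n⇒∣m+n; ∣m∣n⇒∣m-n; ∣m⇒∣-m; ∣ᵤ⇒∣; ∣⇒∣ᵤ) renaming (_∣_ to _∣ₛ_)
import Data.Integer.Tactic.RingSolver as ℤ-Solver
open import Data.Product using (_,_; proj₂)
open import Data.Sum using (_⊎_; inj₁; inj₂)
open import Relation.Binary.Definitions using (tri<; tri≈; tri>)
open import Relation.Binary.PropositionalEquality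
  using (_≢_; refl; sym; trans; cong; subst; module ≡-Reasoning)
open import Relation.Nullary using (yes; no; ¬_)
open import Function using (_∘_)
open import Function.Bundles using (mk⇔)

open ≡-Reasoning

iter-suc : ∀ f k x → iter f (suc k) x ≡ iter f k (f x)
iter-suc f zero    x = refl
iter-suc f (suc k) x = cong f (iter-suc f k x)

Reaches : (ℕ → ℕ) → ℕ → ℕ → Set
Reaches f x y = ∃ λ k → iter f k x ≡ y

reaches-step : ∀ f {x w y} → f x ≡ w → Reaches f w y → Reaches f x y
reaches-step f {x} fx≡w (k , fᵏw≡y) =
  suc k , trans (iter-suc f k x) (trans (cong (iter f k) fx≡w) fᵏw≡y)

module FirstReturn (h G : ℕ → ℕ) (b : ℕ) (D : ℕ → Set)
                   (h-closed : ∀ {x} → D x → D (h x))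
                   (G-step : ∀ {x} → D x → x ≢ b → G x ≡ h x)
                   (G-skip : G b ≡ h (h b)) where

  reaches : ∀ k {x y} → D x → iter h k x ≡ y → y ≢ h b → Reaches G x y
  reaches zero _ x≡y _ = zero , x≡y
  reaches (suc k) {x} Dx hᵏ⁺¹x≡y y≢hb with x ≟ b
  ... | no x≢b =
    reaches-step G (G-step Dx x≢b)
      (reaches k (h-closed Dx) (trans (sym (iter-suc h k x)) hᵏ⁺¹x≡y) y≢hb)
  reaches (suc zero) _ hb≡y y≢hb | yes refl = ⊥-elim (y≢hb (sym hb≡y))
  reaches (suc (suc k)) {y = y} Dx hᵏ⁺²b≡y y≢hb | yes refl =
    reaches-step G G-skip
      (reaches k (h-closed (h-closed Dx)) hᵏhhb≡y y≢hb)
    where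
    hᵏhhb≡y : iter h k (h (h b)) ≡ y
    hᵏhhb≡y = begin
      iter h k (h (h b))     ≡⟨ iter-suc h k (h b) ⟨
      iter h (suc k) (h b)   ≡⟨ iter-suc h (suc k) b ⟨
      iter h (suc (suc k)) b ≡⟨ hᵏ⁺²b≡y ⟩
      y                      ∎

iter-displacement : ∀ {d} f → (∀ x → d ∣ₛ (+ f x - + x)) → ∀ k x → d ∣ₛ (+ iter f k x - + x)
iter-displacement f step zero    x = divides (+ 0) (+-inverseʳ (+ x))
iter-displacement f step (suc k) x =
  subst (_ ∣ₛ_) (split (+ iter f (suc k) x) (+ iter f k x) (+ x))
    (∣m∣n⇒∣m+n (step (iter f k x)) (iter-displacement f step k x))
  where
  split : ∀ u v w → (u - v) ℤ.+ (v - w) ≡ u - w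
  split = ℤ-Solver.solve-∀

∣∸⇒multiple : ∀ {d m n} → m ≤ n → d ∣ℕ (n ∸ m) → ∃ λ c → n ≡ m + c * d
∣∸⇒multiple {m = m} m≤n (divides c n∸m≡cd) = c , trans (sym (m+[n∸m]≡n m≤n)) (cong (λ r → m + r) n∸m≡cd)

difference-multiple : ∀ {d} i j → + d ∣ (+ j - + i) →
                      (∃ λ c → j ≡ i + c * d) ⊎ (∃ λ c → i ≡ j + c * d)
difference-multiple {d} i j d∣j-i with ≤-total i j
... | inj₁ i≤j = inj₁ (∣∸⇒multiple i≤j (subst (d ∣ℕ_) ∣j-i∣≡j∸i d∣j-i))
  where
  ∣j-i∣≡j∸i : ∣ + j - + i ∣ ≡ j ∸ i
  ∣j-i∣≡j∸i = begin
    ∣ + j - + i ∣ ≡⟨ cong ∣_∣ ([+m]-[+n]≡m⊖n j i) ⟩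
    ∣ j ⊖ i ∣     ≡⟨ ∣m⊖n∣≡∣n⊖m∣ j i ⟩
    ∣ i ⊖ j ∣     ≡⟨ ∣⊖∣-≤ i≤j ⟩
    j ∸ i         ∎
... | inj₂ j≤i = inj₂ (∣∸⇒multiple j≤i (subst (d ∣ℕ_) ∣j-i∣≡i∸j d∣j-i))
  where
  ∣j-i∣≡i∸j : ∣ + j - + i ∣ ≡ i ∸ j
  ∣j-i∣≡i∸j = trans (cong ∣_∣ ([+m]-[+n]≡m⊖n j i)) (∣⊖∣-≤ j≤i)

module _ (N : ℕ) .{{_ : NonZero N}} where

  [m%n+o]%n≡[m+o]%n : ∀ m o → (m % N + o) % N ≡ (m + o) % N
  [m%n+o]%n≡[m+o]%n m o = begin
    (m % N + o) % N         ≡⟨ %-distribˡ-+ (m % N) o N ⟩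
    (m % N % N + o % N) % N ≡⟨ cong (λ r → (r + o % N) % N) (m%n%n≡m%n m N) ⟩
    (m % N + o % N) % N     ≡⟨ %-distribˡ-+ m o N ⟨
    (m + o) % N             ∎

  [m+kx]%n≡[m+ky]%n : ∀ m k {x y} → x % N ≡ y % N → (m + k * x) % N ≡ (m + k * y) % N
  [m+kx]%n≡[m+ky]%n m k {x} {y} x≡y = begin
    (m + k * x) % N           ≡⟨ %-distribˡ-+ m (k * x) N ⟩
    (m % N + k * x % N) % N   ≡⟨ cong (λ r → (m % N + r) % N) kx≡ky ⟩
    (m % N + k * y % N) % N   ≡⟨ %-distribˡ-+ m (k * y) N ⟨
    (m + k * y) % N           ∎
    where
    kx≡ky : k * x % N ≡ k * y % N
    kx≡ky = begin
      k * x % N                ≡⟨ %-distribˡ-* k x N ⟩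
      (k % N * (x % N)) % N    ≡⟨ cong (λ r → (k % N * r) % N) x≡y ⟩
      (k % N * (y % N)) % N    ≡⟨ %-distribˡ-* k y N ⟨
      k * y % N                ∎

module Rotation (n p : ℕ) where

  rotate : ℕ → ℕ
  rotate x = (x + p) % suc n

  iter-rotate : ∀ k {x} → x < suc n → iter rotate k x ≡ (x + k * p) % suc n
  iter-rotate zero    {x} x<N = sym (trans (cong (_% suc n) (+-identityʳ x)) (m<n⇒m%n≡m x<N))
  iter-rotate (suc k) {x} x<N = begin
    (iter rotate k x + p) % suc n      ≡⟨ cong (λ r → (r + p) % suc n) (iter-rotate k x<N) ⟩
    ((x + k * p) % suc n + p) % suc n ≡⟨ [m%n+o]%n≡[m+o]%n (suc n) (x + k * p) p ⟩
    (x + k * p + p) % suc n           ≡⟨ cong (_% suc n) (reorder x k p) ⟩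
    (x + suc k * p) % suc n           ∎
    where
    reorder : ∀ x k p → x + k * p + p ≡ x + suc k * p
    reorder = ℕ-Solver.solve-∀

  -- In the second case x * p ≡ - d, and n ≡ - 1, modulo suc n.
  bézout-residue : ∀ {d} → Bézout.Identity d p (suc n) → ∃ λ u → u * p % suc n ≡ d % suc n
  bézout-residue {d} (Bézout.+- x y d+yN≡xp) = x , (begin
    x * p % suc n           ≡⟨ cong (_% suc n) d+yN≡xp ⟨
    (d + y * suc n) % suc n ≡⟨ [m+kn]%n≡m%n d y (suc n) ⟩
    d % suc n               ∎)
  bézout-residue {d} (Bézout.-+ x y d+xp≡yN) = n * x , (begin
    n * x * p % suc n                       ≡⟨ [m+kn]%n≡m%n (n * x * p) y (suc n) ⟨
    (n * x * p + y * suc n) % suc n         ≡⟨ cong (λ r → (n * x * p + r) % suc n) d+xp≡yN ⟨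
    (n * x * p + (d + x * p)) % suc n       ≡⟨ cong (_% suc n) (regroup n x p d) ⟩
    (d + x * p * suc n) % suc n             ≡⟨ [m+kn]%n≡m%n d (x * p) (suc n) ⟩
    d % suc n                               ∎)
    where
    regroup : ∀ n x p d → n * x * p + (d + x * p) ≡ d + x * p * suc n
    regroup = ℕ-Solver.solve-∀

  -- If i exceeds j by c * d, move forward by c * m * d instead, where suc n = suc m * d.
  shift-by-multiple : ∀ {d} i j → d ∣ℕ suc n → + d ∣ (+ j - + i) →
                      ∃ λ c → (i + c * d) % suc n ≡ j % suc n
  shift-by-multiple {d} i j d∣N d∣j-i with difference-multiple i j d∣j-i | d∣N
  ... | inj₁ (c , j≡i+cd) | _ = c , cong (_% suc n) (sym j≡i+cd)
  ... | inj₂ (c , i≡j+cd) | divides (suc m) N≡[1+m]d = c * m , (begin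
    (i + c * m * d) % suc n             ≡⟨ cong (λ r → (r + c * m * d) % suc n) i≡j+cd ⟩
    (j + c * d + c * m * d) % suc n     ≡⟨ cong (_% suc n) (regroup j c d m) ⟩
    (j + c * (suc m * d)) % suc n       ≡⟨ cong (λ r → (j + c * r) % suc n) N≡[1+m]d ⟨
    (j + c * suc n) % suc n             ≡⟨ [m+kn]%n≡m%n j c (suc n) ⟩
    j % suc n                           ∎)
    where
    regroup : ∀ j c d m → j + c * d + c * m * d ≡ j + c * (suc m * d)
    regroup = ℕ-Solver.solve-∀

  rotate-reaches : ∀ {d i j} → GCD p (suc n) d → + d ∣ (+ j - + i) →
                   i < suc n → j < suc n → Reaches rotate i j
  rotate-reaches {d} {i} {j} gcd d∣j-i i<N j<N
    with u , up≡d ← bézout-residue (Bézout.identity gcd)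
       | c , i+cd≡j ← shift-by-multiple i j (proj₂ (GCD.commonDivisor gcd)) d∣j-i
    = c * u , (begin
    iter rotate (c * u) i      ≡⟨ iter-rotate (c * u) i<N ⟩
    (i + c * u * p) % suc n    ≡⟨ cong (λ r → (i + r) % suc n) (*-assoc c u p) ⟩
    (i + c * (u * p)) % suc n  ≡⟨ [m+kx]%n≡[m+ky]%n (suc n) i c up≡d ⟩
    (i + c * d) % suc n        ≡⟨ i+cd≡j ⟩
    j % suc n                  ≡⟨ m<n⇒m%n≡m j<N ⟩
    j                          ∎)

data Region (b : ℕ) : ℕ → Set where
  below : ∀ {x} → x < b → Region b x
  at    : Region b b
  above : ∀ e → Region b (suc b + e)

region : ∀ b x → Region b x
region b x with <-cmp x b
... | tri< x<b _ _ = below x<b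
... | tri≈ _ refl _ = at
... | tri> _ _ b<x = subst (Region b) (m+[n∸m]≡n b<x) (above (x ∸ suc b))

if-T : ∀ {A : Set} {c : Bool} {x y : A} → T c → (if c then x else y) ≡ x
if-T {c = true} _ = refl

if-¬T : ∀ {A : Set} {c : Bool} {x y : A} → ¬ T c → (if c then x else y) ≡ y
if-¬T {c = false} _  = refl
if-¬T {c = true}  ¬t = ⊥-elim (¬t _)

module _ (a b : ℕ) where

  g-below : ∀ {x} → x < b → g (suc a) (suc b) x ≡ x + suc a
  g-below x<b = if-T (<⇒<ᵇ x<b)

  g-at : g (suc a) (suc b) b ≡ a
  g-at = begin
    g (suc a) (suc b) b   ≡⟨ if-¬T (<-irrefl refl ∘ <ᵇ⇒< b b) ⟩
    _                     ≡⟨ if-T (≡⇒≡ᵇ b b refl) ⟩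
    b + suc a ∸ suc b     ≡⟨ cong (_∸ suc b) (+-suc b a) ⟩
    suc b + a ∸ suc b     ≡⟨ m+n∸m≡n (suc b) a ⟩
    a                     ∎

  g-above : ∀ e → g (suc a) (suc b) (suc b + e) ≡ e
  g-above e = begin
    g (suc a) (suc b) (suc b + e) ≡⟨ if-¬T (≤⇒≯ (<⇒≤ b<x) ∘ <ᵇ⇒< _ b) ⟩
    _                             ≡⟨ if-¬T (<⇒≢ b<x ∘ sym ∘ ≡ᵇ⇒≡ _ b) ⟩
    suc b + e ∸ suc b             ≡⟨ m+n∸m≡n (suc b) e ⟩
    e                             ∎
    where
    b<x : b < suc b + e
    b<x = m≤m+n (suc b) e

module Shift (a b : ℕ) where

  p q n : ℕ
  p = suc a
  q = suc b
  n = a + suc b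

  b+p≡n : b + p ≡ n
  b+p≡n = trans (+-comm b p) (sym (+-suc a b))

  below+p<n : ∀ {x} → x < b → x + p < n
  below+p<n {x} x<b = subst (x + p <_) b+p≡n (+-monoˡ-< p x<b)

  g-< : ∀ {x} → x < n → g p q x < n
  g-< {x} x<n with region b x
  ... | below x<b rewrite g-below a b x<b = below+p<n x<b
  ... | at        rewrite g-at a b        = m<m+n a z<s
  ... | above e   rewrite g-above a b e   = <-trans (m<n+m e z<s) x<n

  g-inverse : ∀ {x} → x < n → g q p (g p q x) ≡ x
  g-inverse {x} x<n with region b x
  ... | below x<b rewrite g-below a b x<b | +-comm x p = g-above b a x
  ... | at        rewrite g-at a b        = g-at b a
  ... | above e   rewrite g-above a b e   = trans (g-below b a e<a) (+-comm e q)
    where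
    e<a : e < a
    e<a = +-cancelˡ-< q e a (subst (q + e <_) (+-comm a q) x<n)

  g-injective : ∀ {x y} → x < n → y < n → g p q x ≡ g p q y → x ≡ y
  g-injective {x} {y} x<n y<n gx≡gy = begin
    x                 ≡⟨ g-inverse x<n ⟨
    g q p (g p q x)   ≡⟨ cong (g q p) gx≡gy ⟩
    g q p (g p q y)   ≡⟨ g-inverse y<n ⟩
    y                 ∎

  g-displacement : ∀ {d} → d ∣ₛ + p → d ∣ₛ + q → ∀ x → d ∣ₛ (+ g p q x - + x)
  g-displacement {d} d∣p d∣q x with region b x
  ... | below x<b rewrite g-below a b x<b = subst (d ∣ₛ_) (sym up) d∣p
    where
    up : + (x + p) - + x ≡ + p
    up = trans (cong (_- + x) (pos-+ x p)) (cancel (+ x) (+ p))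
      where
      cancel : ∀ u v → u ℤ.+ v - u ≡ v
      cancel = ℤ-Solver.solve-∀
  ... | at        rewrite g-at a b        = subst (d ∣ₛ_) (sym wrap) (∣m∣n⇒∣m-n d∣p d∣q)
    where
    wrap : + a - + b ≡ + p - + q
    wrap = begin
      + a - + b  ≡⟨ [+m]-[+n]≡m⊖n a b ⟩
      a ⊖ b      ≡⟨ [1+m]⊖[1+n]≡m⊖n a b ⟨
      p ⊖ q      ≡⟨ [+m]-[+n]≡m⊖n p q ⟨
      + p - + q  ∎
  ... | above e   rewrite g-above a b e   = subst (d ∣ₛ_) (sym down) (∣m⇒∣-m d∣q)
    where
    down : + e - + (q + e) ≡ - + q
    down = trans (cong (λ r → + e - r) (pos-+ q e)) (cancel (+ e) (+ q))
      where
      cancel : ∀ u v → u - (v ℤ.+ u) ≡ - v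
      cancel = ℤ-Solver.solve-∀

  open Rotation n p using (rotate; rotate-reaches)

  rotate-above : ∀ {e} → e < suc n → rotate (q + e) ≡ e
  rotate-above {e} e<N = begin
    (q + e + p) % suc n  ≡⟨ cong (_% suc n) (regroup a b e) ⟩
    (e + suc n) % suc n  ≡⟨ [m+n]%n≡m%n e (suc n) ⟩
    e % suc n            ≡⟨ m<n⇒m%n≡m e<N ⟩
    e                    ∎
    where
    regroup : ∀ a b e → suc b + e + suc a ≡ e + suc (a + suc b)
    regroup = ℕ-Solver.solve-∀

  rotate-b : rotate b ≡ n
  rotate-b = trans (cong (_% suc n) b+p≡n) (m<n⇒m%n≡m ≤-refl)

  rotate-n : rotate n ≡ a
  rotate-n = trans (cong rotate (+-comm a q)) (rotate-above (s≤s (m≤m+n a q)))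

  g≡rotate : ∀ {x} → x < suc n → x ≢ b → g p q x ≡ rotate x
  g≡rotate {x} x<N x≢b with region b x
  ... | below x<b rewrite g-below a b x<b = sym (m<n⇒m%n≡m (m<n⇒m<1+n (below+p<n x<b)))
  ... | at                                = ⊥-elim (x≢b refl)
  ... | above e   rewrite g-above a b e   = sym (rotate-above (≤-<-trans (m≤n+m e q) x<N))

  g-skip : g p q b ≡ rotate (rotate b)
  g-skip = begin
    g p q b             ≡⟨ g-at a b ⟩
    a                   ≡⟨ rotate-n ⟨
    rotate n            ≡⟨ cong rotate rotate-b ⟨
    rotate (rotate b)   ∎

  orbit⇒residue : ∀ {i j} → Reaches (g p q) i j → + gcd p q ∣ (+ j - + i)
  orbit⇒residue {i} (k , refl) =
    ∣⇒∣ᵤ (iter-displacement (g p q) (g-displacement gcd∣p gcd∣q) k i)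
    where
    gcd∣p : + gcd p q ∣ₛ + p
    gcd∣p = ∣ᵤ⇒∣ (gcd[m,n]∣m p q)
    gcd∣q : + gcd p q ∣ₛ + q
    gcd∣q = ∣ᵤ⇒∣ (gcd[m,n]∣n p q)

  residue⇒orbit : ∀ {i j} → i < n → j < n → + gcd p q ∣ (+ j - + i) → Reaches (g p q) i j
  residue⇒orbit {i} {j} i<n j<n gcd∣j-i
    with k , rᵏi≡j ← rotate-reaches (GCD.step (gcd-GCD p q)) gcd∣j-i (m<n⇒m<1+n i<n) (m<n⇒m<1+n j<n)
    = FirstReturn.reaches rotate (g p q) b (_< suc n) (λ {x} _ → m%n<n (x + p) (suc n))
        g≡rotate g-skip k (m<n⇒m<1+n i<n) rᵏi≡j (λ j≡rb → <⇒≢ j<n (trans j≡rb rotate-b))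

theorem2p2 : (p' q' : ℕ) → 1 ≤ p' → 1 ≤ q' →
    -- g maps [0, n-1] into itself
    ((i : ℕ) → i < p' + q' ∸ 1 → g p' q' i < p' + q' ∸ 1)
    -- g is injective on [0, n-1] (hence a permutation of this finite set)
    × ((i j : ℕ) → i < p' + q' ∸ 1 → j < p' + q' ∸ 1 →
         g p' q' i ≡ g p' q' j → i ≡ j)
    -- the orbit of i is exactly the residue class of i mod gcd(p', q') in [0, n-1]
    × ((i j : ℕ) → i < p' + q' ∸ 1 → j < p' + q' ∸ 1 →
         ((∃ λ k → iter (g p' q') k i ≡ j) ⇔ (+ gcd p' q' ∣ (+ j - + i))))
theorem2p2 (suc a) (suc b) _ _ =
    (λ _ → g-<)
  , (λ _ _ → g-injective)
  , λ _ _ i<n j<n → mk⇔ orbit⇒residue (residue⇒orbit i<n j<n)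
  where open Shift a b
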